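{- Let $G$ be a complete graph $K_n$, a star graph, a wheel graph $W_n$, or a friendship graph $F_k$. Then for every colouring $c$ of $G$, $G$ is $1$-local with respect to $c$, i.e. $\operatorname{loc}(G,c)\le 1$.
   Context: $K_n=([n],\binom{[n]}{2})$. A star graph is $(\{1,\dots,n\},\{\{1,i\}\mid i>1\})$. The wheel graph $W_n$ is obtained by joining a single new vertex to every vertex of a cycle on $n-1$ vertices. The friendship graph $F_k$ consists of $k$ copies of a $3$-cycle sharing one common vertex. A colouring of $G=(V,E)$ is any function $c:V\to[\ell]$. Let $\mathcal C(G,c)=c(V)$, $m=|\mathcal C(G,c)|$; a marking sequence is an enumeration $e=(x_1,\dots,x_m)$ of $\mathcal C(G,c)$; $G_i$ is the subgraph induced by the vertices with colours in $\{x_1,\dots,x_i\}$; with $\gamma(H)$ the number of connected components, $\operatorname{loc}(G,c,e)=\max_i\gamma(G_i)$, $\operatorname{loc}(G,c)=\min_e\operatorname{loc}(G,c,e)$. $G$ is $k$-local w.r.t. $c$ if $\operatorname{loc}(G,c)\le k$. -}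

module Defs where

open import Data.Nat using (ℕ; zero; suc; _+_; _*_; _∸_; _≤_)
open import Data.Fin using (Fin; toℕ)
open import Data.List using (List; length; take)
open import Data.List.Membership.Propositional using (_∈_)
open import Data.List.Relation.Unary.Any using (Any)
open import Data.List.Relation.Unary.Unique.Propositional using (Unique)
open import Data.Product using (Σ; ∃; _×_; _,_)
open import Data.Sum using (_⊎_)
open import Relation.Binary.PropositionalEquality using (_≡_; _≢_)

record Graph : Set₁ where
  field
    V : ℕ
    E : Fin V → Fin V → Set
open Graph public

-- The graph families (vertices indexed from 0 instead of 1).

complete : ℕ → Graph
complete n = record { V = n ; E = λ i j → i ≢ j }

star : ℕ → Graph
star n = record { V = n ; E = λ i j →
  (toℕ i ≡ 0 × toℕ j ≢ 0) ⊎ (toℕ j ≡ 0 × toℕ i ≢ 0) }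

-- Wheel W_n : hub 0 joined to every vertex of the cycle 1 - 2 - ... - (n-1) - 1
-- (a cycle on n-1 vertices; meaningful for n ≥ 4).
wheelEdge : ℕ → ℕ → ℕ → Set
wheelEdge n a b =
  (a ≡ 0 × b ≢ 0) ⊎ (b ≡ 0 × a ≢ 0) ⊎
  (1 ≤ a × b ≡ suc a × b ≤ n ∸ 1) ⊎ (1 ≤ b × a ≡ suc b × a ≤ n ∸ 1) ⊎
  (a ≡ 1 × b ≡ n ∸ 1) ⊎ (b ≡ 1 × a ≡ n ∸ 1)

wheel : ℕ → Graph
wheel n = record { V = n ; E = λ i j → wheelEdge n (toℕ i) (toℕ j) }

-- Friendship graph F_k : vertex 0 is the common vertex, the j-th triangle
-- (j < k) is {0, 2j+1, 2j+2}.
friendshipEdge : ℕ → ℕ → Set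
friendshipEdge a b =
  (a ≡ 0 × b ≢ 0) ⊎ (b ≡ 0 × a ≢ 0) ⊎
  (∃ λ j → a ≡ 1 + 2 * j × b ≡ 2 + 2 * j) ⊎
  (∃ λ j → b ≡ 1 + 2 * j × a ≡ 2 + 2 * j)

friendship : ℕ → Graph
friendship k = record { V = suc (2 * k) ; E = λ i j → friendshipEdge (toℕ i) (toℕ j) }

data Reach {n : ℕ} (E : Fin n → Fin n → Set) (P : Fin n → Set)
           : Fin n → Fin n → Set where
  here : ∀ {v} → P v → Reach E P v v
  step : ∀ {u w v} → P u → E u w → Reach E P w v → Reach E P u v

-- γ(H) ≤ k for the subgraph H of (Fin n, E) induced by P: there are at most
-- k vertices such that every vertex of H lies in the component of one of them.
ComponentsAtMost : {n : ℕ} → (Fin n → Fin n → Set) → (Fin n → Set) → ℕ → Set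
ComponentsAtMost {n} E P k =
  Σ (List (Fin n)) λ rs → length rs ≤ k × (∀ v → P v → Any (Reach E P v) rs)

MarkingSeq : {n ℓ : ℕ} → (Fin n → Fin ℓ) → List (Fin ℓ) → Set
MarkingSeq {n} c xs =
  Unique xs × (∀ x → x ∈ xs → ∃ λ v → c v ≡ x) × (∀ v → c v ∈ xs)

Gi : {n ℓ : ℕ} → (Fin n → Fin ℓ) → List (Fin ℓ) → ℕ → Fin n → Set
Gi c xs i v = c v ∈ take i xs

LocSeqAtMost : (G : Graph) {ℓ : ℕ} → (Fin (V G) → Fin ℓ) → List (Fin ℓ) → ℕ → Set
LocSeqAtMost G c xs k =
  ∀ i → 1 ≤ i → i ≤ length xs → ComponentsAtMost (E G) (Gi c xs i) k

-- G is k-local w.r.t. c : loc(G,c) = min_e loc(G,c,e) ≤ k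
IsLocal : (G : Graph) {ℓ : ℕ} → (Fin (V G) → Fin ℓ) → ℕ → Set
IsLocal G c k = Σ (List _) λ xs → MarkingSeq c xs × LocSeqAtMost G c xs k

-- Each of these graphs has a vertex adjacent to all others (the centre of the
-- star, wheel and friendship graph, any vertex of K_n). Mark its colour first:
-- every G_i then contains that vertex, hence is connected through it.
module Submission where

open import Defs
open import Data.Nat using (_≤_; zero; suc; s≤s; z≤n)
open import Data.Fin using (Fin; toℕ) renaming (zero to fzero)
open import Data.Fin.Properties using (toℕ-injective; _≟_)
open import Data.Product using (_×_; _,_; ∃)
open import Data.Sum using (inj₁; inj₂)
open import Data.List using (List; []; _∷_; map; allFin; deduplicate)
open import Data.List.Relation.Unary.Any using (Any; here; there)
open import Data.List.Relation.Unary.Unique.Propositional using ([])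
open import Data.List.Relation.Unary.Unique.DecPropositional.Properties using (deduplicate-!)
open import Data.List.Membership.Propositional using (_∈_)
open import Data.List.Membership.Propositional.Properties
  using (∈-deduplicate⁻; ∈-deduplicate⁺; ∈-map⁻; ∈-map⁺; ∈-allFin)
open import Relation.Binary.PropositionalEquality using (_≡_; _≢_; refl; sym)
open import Data.Empty using (⊥-elim)
open import Relation.Nullary using (¬_; yes; no)

Dominating : (G : Graph) → Fin (V G) → Set
Dominating G h = ∀ v → v ≢ h → E G v h

componentsAtMost-one-of-dominating : ∀ {n} {E : Fin n → Fin n → Set} {P : Fin n → Set} {h} →
  (∀ v → v ≢ h → E v h) → P h → ComponentsAtMost E P 1
componentsAtMost-one-of-dominating {E = E} {P} {h} dom Ph = h ∷ [] , s≤s z≤n , reach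
  where
  reach : ∀ v → P v → Any (Reach E P v) (h ∷ [])
  reach v Pv with v ≟ h
  ... | yes refl = here (Reach.here Pv)
  ... | no v≢h   = here (Reach.step Pv (dom v v≢h) (Reach.here Ph))

coloursFrom : ∀ {n ℓ} → Fin n → (Fin n → Fin ℓ) → List (Fin ℓ)
coloursFrom {n} h c = deduplicate _≟_ (map c (h ∷ allFin n))

coloursFrom-markingSeq : ∀ {n ℓ} (h : Fin n) (c : Fin n → Fin ℓ) → MarkingSeq c (coloursFrom h c)
coloursFrom-markingSeq {n} h c = deduplicate-! _≟_ (map c (h ∷ allFin n)) , coloured , complete-list
  where
  coloured : ∀ x → x ∈ coloursFrom h c → ∃ λ v → c v ≡ x
  coloured x x∈ with ∈-map⁻ c (∈-deduplicate⁻ _≟_ (map c (h ∷ allFin n)) x∈)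
  ... | v , _ , x≡cv = v , sym x≡cv
  complete-list : ∀ v → c v ∈ coloursFrom h c
  complete-list v = ∈-deduplicate⁺ _≟_ (∈-map⁺ c (there (∈-allFin v)))

-- deduplicate keeps the first occurrence, so c h heads the sequence.
Gi-coloursFrom-start : ∀ {n ℓ} (h : Fin n) (c : Fin n → Fin ℓ) i → Gi c (coloursFrom h c) (suc i) h
Gi-coloursFrom-start h c i = here refl

dominating⇒1-local : ∀ G {ℓ} (h : Fin (V G)) → Dominating G h → (c : Fin (V G) → Fin ℓ) → IsLocal G c 1
dominating⇒1-local G h dom c = coloursFrom h c , coloursFrom-markingSeq h c , loc
  where
  loc : LocSeqAtMost G c (coloursFrom h c) 1
  loc (suc i) _ _ = componentsAtMost-one-of-dominating dom (Gi-coloursFrom-start h c i)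

vertexless⇒local : ∀ G {ℓ} k → ¬ Fin (V G) → (c : Fin (V G) → Fin ℓ) → IsLocal G c k
vertexless⇒local G k noVertex c = [] , ([] , (λ _ ()) , λ v → ⊥-elim (noVertex v)) , λ { zero () _ }

toℕ≢0 : ∀ {n} {v : Fin (suc n)} → v ≢ fzero → toℕ v ≢ 0
toℕ≢0 v≢0 eq = v≢0 (toℕ-injective eq)

complete-dominating : ∀ m → Dominating (complete (suc m)) fzero
complete-dominating m v v≢0 = v≢0

star-dominating : ∀ m → Dominating (star (suc m)) fzero
star-dominating m v v≢0 = inj₂ (refl , toℕ≢0 v≢0)

wheel-dominating : ∀ m → Dominating (wheel (suc m)) fzero
wheel-dominating m v v≢0 = inj₂ (inj₁ (refl , toℕ≢0 v≢0))

friendship-dominating : ∀ k → Dominating (friendship k) fzero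
friendship-dominating k v v≢0 = inj₂ (inj₁ (refl , toℕ≢0 v≢0))

proposition13 :
    (∀ n ℓ (c : Fin (V (complete n)) → Fin ℓ) → IsLocal (complete n) c 1) ×
    (∀ n ℓ (c : Fin (V (star n)) → Fin ℓ) → IsLocal (star n) c 1) ×
    (∀ n → 4 ≤ n → ∀ ℓ (c : Fin (V (wheel n)) → Fin ℓ) → IsLocal (wheel n) c 1) ×
    (∀ k → 1 ≤ k → ∀ ℓ (c : Fin (V (friendship k)) → Fin ℓ) → IsLocal (friendship k) c 1)
proposition13 = completeLocal , starLocal , wheelLocal , friendshipLocal
  where
  completeLocal : ∀ n ℓ (c : Fin (V (complete n)) → Fin ℓ) → IsLocal (complete n) c 1
  completeLocal zero    ℓ = vertexless⇒local (complete 0) 1 λ ()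
  completeLocal (suc m) ℓ = dominating⇒1-local (complete (suc m)) fzero (complete-dominating m)
  starLocal : ∀ n ℓ (c : Fin (V (star n)) → Fin ℓ) → IsLocal (star n) c 1
  starLocal zero    ℓ = vertexless⇒local (star 0) 1 λ ()
  starLocal (suc m) ℓ = dominating⇒1-local (star (suc m)) fzero (star-dominating m)
  wheelLocal : ∀ n → 4 ≤ n → ∀ ℓ (c : Fin (V (wheel n)) → Fin ℓ) → IsLocal (wheel n) c 1
  wheelLocal (suc m) _ ℓ = dominating⇒1-local (wheel (suc m)) fzero (wheel-dominating m)
  friendshipLocal : ∀ k → 1 ≤ k → ∀ ℓ (c : Fin (V (friendship k)) → Fin ℓ) → IsLocal (friendship k) c 1
  friendshipLocal k _ ℓ = dominating⇒1-local (friendship k) fzero (friendship-dominating k)
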